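{- Let $S=\{a,b,c\}$ with $4\le a<b<c$ integers, $\gcd(a,b)=1$, $b\le \frac12\left(a^2-a+\sqrt{a^4-2a^3-3a^2}\right)$, and $c=ab-a-b$ (the Frobenius number of $\langle a,b\rangle$). Then $\langle S\rangle$ is greedy.
   Context: For a finite set $S=\{s_1<s_2<\dots<s_t\}$ of positive integers with $\gcd(s_1,\dots,s_t)=1$, let $\langle S\rangle=\{\sum_i\alpha_is_i:\alpha_i\in\mathbb{N}_0\}$ be the numerical semigroup it generates. For $k\in\langle S\rangle$, a representation of $k$ is a vector $(a_1,\dots,a_t)\in\mathbb{N}_0^t$ with $\sum_i a_is_i=k$; its cost is $\sum_i a_i$, and $\mathrm{MinCost}_S(k)$ is the minimum cost over all representations of $k$. The greedy representation of $k$ is produced as follows: set all $a_i=0$ and $i=t$; while $k>0$, let $q$ be the largest nonnegative integer such that $k=qs_i+r$ with $r\in\langle S\rangle$, set $a_i=q$, $k\leftarrow r$, $i\leftarrow i-1$. $\mathrm{GreedyCost}_S(k)$ is the cost of the greedy representation. The semigroup $\langle S\rangle$ is called greedy if $\mathrm{GreedyCost}_S(k)=\mathrm{MinCost}_S(k)$ for every $k\in\langle S\rangle$. -}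

module Defs where

open import Data.Nat using (ℕ; zero; suc; _+_; _*_; _∸_; _^_; _≤_; _<_)
open import Data.Vec using (Vec; []; _∷_; zipWith; sum; toList)
open import Data.List using (List; []; _∷_; reverse)
import Data.Nat.ListAction as LA
open import Data.Product using (Σ; ∃; _×_; _,_)
open import Data.Sum using (_⊎_)
open import Relation.Binary.PropositionalEquality using (_≡_)

-- Generators S = (s₁ < … < s_t) given as a vector (in increasing order).
-- A representation vector a has value Σ aᵢ sᵢ and cost Σ aᵢ.
value : ∀ {t} → Vec ℕ t → Vec ℕ t → ℕ
value S a = sum (zipWith _*_ a S)

cost : ∀ {t} → Vec ℕ t → ℕ
cost a = sum a

InSG : ∀ {t} → Vec ℕ t → ℕ → Set
InSG {t} S k = Σ (Vec ℕ t) λ a → value S a ≡ k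

IsMinCost : ∀ {t} → Vec ℕ t → ℕ → ℕ → Set
IsMinCost {t} S k m =
  (Σ (Vec ℕ t) λ a → value S a ≡ k × cost a ≡ m) ×
  (∀ (a : Vec ℕ t) → value S a ≡ k → m ≤ cost a)

-- At each step q is the LARGEST q with k = q s + r, r ∈ ⟨S⟩
-- (membership in the whole semigroup ⟨S⟩, as in the paper).
data GreedyRun {t} (S : Vec ℕ t) : List ℕ → ℕ → List ℕ → Set where
  done : GreedyRun S [] 0 []
  step : ∀ {s ss k q r qs} →
         k ≡ q * s + r →
         InSG S r →
         (∀ q' r' → k ≡ q' * s + r' → InSG S r' → q' ≤ q) →
         GreedyRun S ss r qs →
         GreedyRun S (s ∷ ss) k (q ∷ qs)

IsGreedyCost : ∀ {t} → Vec ℕ t → ℕ → ℕ → Set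
IsGreedyCost S k m =
  Σ (List ℕ) λ qs → GreedyRun S (reverse (toList S)) k qs × LA.sum qs ≡ m

IsGreedy : ∀ {t} → Vec ℕ t → Set
IsGreedy S =
  (∀ k → InSG S k → Σ ℕ λ m → IsGreedyCost S k m) ×
  (∀ k m → IsGreedyCost S k m → IsMinCost S k m)

-- b ≤ (a² - a + √(a⁴ - 2a³ - 3a²)) / 2, rendered without reals:
-- equivalently 2b + a - a² ≤ √(a⁴-2a³-3a²), i.e. either the left side is ≤ 0,
-- or it is positive and its square is ≤ a⁴ - 2a³ - 3a².
SqrtBound : ℕ → ℕ → Set
SqrtBound a b =
  (2 * b + a ≤ a ^ 2) ⊎
  (a ^ 2 < 2 * b + a × (2 * b + a ∸ a ^ 2) ^ 2 + 2 * a ^ 3 + 3 * a ^ 2 ≤ a ^ 4)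

-- With c = ab − a − b we have (a − 1) b = c + a and (b − 1) a = c + b.  For three positive
-- generators the greedy algorithm always ends at 0, giving k = q_c c + R with R = q_a a + q_b b,
-- where q_c is maximal and q_b is maximal among the representations of R by a and b.
-- If x a + y b + z c = k then z ≤ q_c, and writing q_c = z + j it suffices that x a + y b = j c + R
-- forces x + y ≥ j + q_a + q_b.  When y ≥ a − 1 (or x ≥ b − 1),
-- a − 1 copies of b (or b − 1 copies of a) are exchanged for one c and one a (or one b), which
-- lowers x + y by at least 2.  Otherwise x ≤ b − 2 and y ≤ a − 2, so x a + y b ≤ 2c: then j = 1 is
-- excluded by the maximality of q_b and gcd(a, b) = 1, and j = 2 forces R = 0 and y = a − 2 ≥ 2.
module Submission where

open import Defs
open import Data.Nat
  using (ℕ; zero; suc; _+_; _*_; _∸_; _≤_; _<_; z≤n; s≤s; NonZero; >-nonZero; _≟_; _≤?_)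
open import Data.Nat.Properties
open import Data.Nat.Coprimality using (Coprime; gcd≡1⇒coprime; coprime-divisor)
open import Data.Nat.Divisibility using (_∣_; ∣m+n∣m⇒∣n; n∣m*n; ∣⇒≤)
open import Data.Nat.GCD using (gcd)
open import Data.Nat.Tactic.RingSolver using (solve-∀)
open import Data.List using ([]; _∷_)
open import Data.Vec using (Vec; []; _∷_; zipWith)
open import Data.Product using (∃; _×_; _,_)
open import Data.Sum using (_⊎_; inj₁; inj₂)
open import Data.Empty using (⊥; ⊥-elim)
open import Relation.Nullary using (yes; no; ¬_; contradiction)
open import Relation.Nullary.Decidable using (map′; _×-dec_)
open import Relation.Unary using (Decidable)
open import Relation.Binary.PropositionalEquality
  using (_≡_; refl; sym; trans; cong; cong₂; subst; module ≡-Reasoning)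
open import Algebra.Properties.CommutativeSemigroup +-commutativeSemigroup
  using (interchange; x∙yz≈y∙xz)

greatest-witness : ∀ {P : ℕ → Set} → Decidable P → ∀ n → (∀ q → P q → q ≤ n) → P 0 →
                   ∃ λ q → P q × (∀ q′ → P q′ → q′ ≤ q)
greatest-witness P? zero    bounded p₀ = 0 , p₀ , bounded
greatest-witness {P} P? (suc n) bounded p₀ with P? (suc n)
... | yes p = suc n , p , bounded
... | no ¬p = greatest-witness P? n bounded′ p₀
  where
  bounded′ : ∀ q → P q → q ≤ n
  bounded′ q pq = ≤-pred (≤∧≢⇒< (bounded q pq) λ q≡1+n → ¬p (subst P q≡1+n pq))

value-zipWith-+ : ∀ {t} (S u v : Vec ℕ t) → value S (zipWith _+_ u v) ≡ value S u + value S v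
value-zipWith-+ []      []      []      = refl
value-zipWith-+ (s ∷ S) (x ∷ u) (y ∷ v) = begin
  (x + y) * s + value S (zipWith _+_ u v)  ≡⟨ cong₂ _+_ (*-distribʳ-+ s x y) (value-zipWith-+ S u v) ⟩
  (x * s + y * s) + (value S u + value S v) ≡⟨ interchange (x * s) (y * s) (value S u) (value S v) ⟩
  (x * s + value S u) + (y * s + value S v) ∎
  where open ≡-Reasoning

InSG-+ : ∀ {t} {S : Vec ℕ t} {m n} → InSG S m → InSG S n → InSG S (m + n)
InSG-+ {S = S} (u , refl) (v , refl) = zipWith _+_ u v , value-zipWith-+ S u v

module Greedy {t} (S : Vec ℕ t) where

  _≼_ : ℕ → ℕ → Set
  s ≼ r = ∃ λ r′ → r ≡ s + r′ × InSG S r′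

  ≼-+ : ∀ {m s r n} → InSG S m → s ≼ r → n ≡ m + r → s ≼ n
  ≼-+ {m} {s} m∈S (r′ , refl , r′∈S) n≡m+r =
    m + r′ , trans n≡m+r (x∙yz≈y∙xz m s r′) , InSG-+ m∈S r′∈S

  Maximal : ℕ → ℕ → ℕ → Set
  Maximal s k q = ∀ q′ r′ → k ≡ q′ * s + r′ → InSG S r′ → q′ ≤ q

  maximal-¬≼ : ∀ {s k q r} → Maximal s k q → k ≡ q * s + r → ¬ (s ≼ r)
  maximal-¬≼ {s} {k} {q} maximal k≡qs+r (r′ , refl , r′∈S) =
    1+n≰n (maximal (suc q) r′ k≡[1+q]s+r′ r′∈S)
    where
    k≡[1+q]s+r′ : k ≡ suc q * s + r′
    k≡[1+q]s+r′ = trans k≡qs+r (trans (sym (+-assoc (q * s) s r′)) (cong (_+ r′) (+-comm (q * s) s)))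

  greedy-step : Decidable (InSG S) → ∀ s .{{_ : NonZero s}} k → InSG S k →
                ∃ λ q → ∃ λ r → k ≡ q * s + r × InSG S r × Maximal s k q
  greedy-step InSG? s k k∈S
    with greatest-witness Fits? k (λ { q (qs≤k , _) → ≤-trans (m≤m*n q s) qs≤k }) (z≤n , k∈S)
    where
    Fits : ℕ → Set
    Fits q = q * s ≤ k × InSG S (k ∸ q * s)
    Fits? : Decidable Fits
    Fits? q = (q * s ≤? k) ×-dec InSG? (k ∸ q * s)
  ... | q , (qs≤k , rest∈S) , greatest = q , k ∸ q * s , sym (m+[n∸m]≡n qs≤k) , rest∈S , maximal
    where
    maximal : Maximal s k q
    maximal q′ r′ k≡q′s+r′ r′∈S = greatest q′
      ( subst (q′ * s ≤_) (sym k≡q′s+r′) (m≤m+n (q′ * s) r′)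
      , subst (InSG S) (sym (trans (cong (_∸ q′ * s) k≡q′s+r′) (m+n∸m≡n (q′ * s) r′))) r′∈S )

module ThreeGenerators (a b c : ℕ) .{{_ : NonZero a}} .{{_ : NonZero b}} .{{_ : NonZero c}} where

  S : Vec ℕ 3
  S = a ∷ b ∷ c ∷ []

  open Greedy S public

  private
    rotate : ∀ p q r → p + (q + (r + 0)) ≡ r + (p + q)
    rotate = solve-∀

  value-S : ∀ x y z → value S (x ∷ y ∷ z ∷ []) ≡ z * c + (x * a + y * b)
  value-S x y z = rotate (x * a) (y * b) (z * c)

  cost-S : ∀ x y z → cost (x ∷ y ∷ z ∷ []) ≡ z + (x + y)
  cost-S x y z = rotate x y z

  a-multiple-∈ : ∀ q → InSG S (q * a)
  a-multiple-∈ q = (q ∷ 0 ∷ 0 ∷ []) , +-identityʳ (q * a)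

  b-multiple-∈ : ∀ q → InSG S (q * b)
  b-multiple-∈ q = (0 ∷ q ∷ 0 ∷ []) , +-identityʳ (q * b)

  InSG? : Decidable (InSG S)
  InSG? n = map′ from to
    (anyUpTo? (λ x → anyUpTo? (λ y → anyUpTo? (λ z →
      value S (x ∷ y ∷ z ∷ []) ≟ n) (suc n)) (suc n)) (suc n))
    where
    Bounded : Set
    Bounded = ∃ λ x → x < suc n × ∃ λ y → y < suc n × ∃ λ z → z < suc n × value S (x ∷ y ∷ z ∷ []) ≡ n
    from : Bounded → InSG S n
    from (x , _ , y , _ , z , _ , v≡n) = (x ∷ y ∷ z ∷ []) , v≡n
    to : InSG S n → Bounded
    to ((x ∷ y ∷ z ∷ []) , v≡n) = x , bound x≤v , y , bound y≤v , z , bound z≤v , v≡n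
      where
      v = value S (x ∷ y ∷ z ∷ [])
      bound : ∀ {m} → m ≤ v → m < suc n
      bound m≤v = s≤s (subst (_ ≤_) v≡n m≤v)
      x≤v : x ≤ v
      x≤v = ≤-trans (m≤m*n x a) (m≤m+n (x * a) _)
      y≤v : y ≤ v
      y≤v = ≤-trans (m≤m*n y b) (≤-trans (m≤m+n (y * b) _) (m≤n+m _ (x * a)))
      z≤v : z ≤ v
      z≤v = ≤-trans (m≤m*n z c) (≤-trans (m≤m+n (z * c) 0) (≤-trans (m≤n+m _ (y * b)) (m≤n+m _ (x * a))))

  zero-or-generator-≼ : ∀ {r} → InSG S r → r ≡ 0 ⊎ a ≼ r ⊎ b ≼ r ⊎ c ≼ r
  zero-or-generator-≼ ((zero  ∷ zero  ∷ zero  ∷ []) , refl) = inj₁ refl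
  zero-or-generator-≼ ((suc x ∷ y     ∷ z     ∷ []) , refl) =
    inj₂ (inj₁ (_ , +-assoc a (x * a) _ , (x ∷ y ∷ z ∷ []) , refl))
  zero-or-generator-≼ ((zero  ∷ suc y ∷ z     ∷ []) , refl) =
    inj₂ (inj₂ (inj₁ (_ , +-assoc b (y * b) _ , (0 ∷ y ∷ z ∷ []) , refl)))
  zero-or-generator-≼ ((zero  ∷ zero  ∷ suc z ∷ []) , refl) =
    inj₂ (inj₂ (inj₂ (_ , +-assoc c (z * c) 0 , (0 ∷ 0 ∷ z ∷ []) , refl)))

  greedy-exhausts : ∀ {k qc r₁ qb r₂ qa r₃} →
                    k ≡ qc * c + r₁ → Maximal c k qc →
                    r₁ ≡ qb * b + r₂ → Maximal b r₁ qb →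
                    r₂ ≡ qa * a + r₃ → Maximal a r₂ qa →
                    InSG S r₃ → r₃ ≡ 0
  greedy-exhausts {qb = qb} {qa = qa} k≡ max-c r₁≡ max-b r₂≡ max-a r₃∈S
    with zero-or-generator-≼ r₃∈S
  ... | inj₁ r₃≡0               = r₃≡0
  ... | inj₂ (inj₁ a≼r₃)        = contradiction a≼r₃ (maximal-¬≼ max-a r₂≡)
  ... | inj₂ (inj₂ (inj₁ b≼r₃)) =
    contradiction (≼-+ (a-multiple-∈ qa) b≼r₃ r₂≡) (maximal-¬≼ max-b r₁≡)
  ... | inj₂ (inj₂ (inj₂ c≼r₃)) =
    contradiction (≼-+ (b-multiple-∈ qb) (≼-+ (a-multiple-∈ qa) c≼r₃ r₂≡) r₁≡) (maximal-¬≼ max-c k≡)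

  greedyCost-exists : ∀ k → InSG S k → ∃ (IsGreedyCost S k)
  greedyCost-exists k k∈S with greedy-step InSG? c k k∈S
  ... | qc , r₁ , k≡ , r₁∈S , max-c with greedy-step InSG? b r₁ r₁∈S
  ... | qb , r₂ , r₁≡ , r₂∈S , max-b with greedy-step InSG? a r₂ r₂∈S
  ... | qa , r₃ , r₂≡ , r₃∈S , max-a =
    _ , (qc ∷ qb ∷ qa ∷ []) ,
    step k≡ r₁∈S max-c (step r₁≡ r₂∈S max-b (step r₂≡ r₃∈S max-a run-ends)) , refl
    where
    run-ends : GreedyRun S [] r₃ []
    run-ends = subst (λ r → GreedyRun S [] r [])
                     (sym (greedy-exhausts k≡ max-c r₁≡ max-b r₂≡ max-a r₃∈S)) done

coefficient-exchange-≤ : ∀ {a b} .{{_ : NonZero a}} → a ≤ b → ∀ x y p d →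
                         x * a + y * b ≡ p * a + (y + d) * b → p + d ≤ x
coefficient-exchange-≤ {a} {b} a≤b x y p d eq = *-cancelʳ-≤ (p + d) x a (begin
  (p + d) * a    ≡⟨ *-distribʳ-+ a p d ⟩
  p * a + d * a  ≤⟨ +-monoʳ-≤ (p * a) (*-monoʳ-≤ d a≤b) ⟩
  p * a + d * b  ≡⟨ +-cancelʳ-≡ (y * b) _ _ (trans (sym (regroup (p * a) y d b)) (sym eq)) ⟩
  x * a          ∎)
  where
  open ≤-Reasoning
  regroup : ∀ pa y d b → pa + (y + d) * b ≡ pa + d * b + y * b
  regroup = solve-∀

coprime-∣-coefficient : ∀ {a b} → Coprime a b → ∀ x y p → x * a + y * b ≡ p * a → a ∣ y
coprime-∣-coefficient {a} {b} coprime x y p eq =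
  coprime-divisor coprime (∣m+n∣m⇒∣n (subst (a ∣_) eq′ (n∣m*n p)) (n∣m*n x))
  where
  eq′ : p * a ≡ x * a + b * y
  eq′ = trans (sym eq) (cong (x * a +_) (*-comm y b))

box-saturation : ∀ {a b} x y w → 2 + x ≤ b → 2 + y ≤ a →
                 (2 + x) * a + (2 + y) * b ≡ 2 * (a * b) + w → w ≡ 0 × 2 + y ≡ a
box-saturation x y w 2+x≤b 2+y≤a eq
  with m≤n⇒∃[o]m+o≡n 2+x≤b | m≤n⇒∃[o]m+o≡n 2+y≤a
... | u , refl | v , refl =
  m+n≡0⇒m≡0 w w+E≡0 , sym (trans (cong (2 + y +_) v≡0) (+-identityʳ (2 + y)))
  where
  A B E : ℕ
  A = 2 + y + v
  B = 2 + x + u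
  E = v * (2 + x) + u * (2 + y) + 2 * (u * v)
  expand : ∀ x y u v → 2 * ((2 + y + v) * (2 + x + u)) ≡
           (2 + x) * (2 + y + v) + (2 + y) * (2 + x + u) + (v * (2 + x) + u * (2 + y) + 2 * (u * v))
  expand = solve-∀
  w+E≡0 : w + E ≡ 0
  w+E≡0 = sym (+-cancelˡ-≡ (2 * (A * B)) 0 (w + E) (begin
    2 * (A * B) + 0                        ≡⟨ +-identityʳ _ ⟩
    2 * (A * B)                            ≡⟨ expand x y u v ⟩
    (2 + x) * A + (2 + y) * B + E          ≡⟨ cong (_+ E) eq ⟩
    2 * (A * B) + w + E                    ≡⟨ +-assoc (2 * (A * B)) w E ⟩
    2 * (A * B) + (w + E)                  ∎))
    where open ≡-Reasoning
  v≡0 : v ≡ 0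
  v≡0 = m*n≡0⇒m≡0 v (2 + x) (m+n≡0⇒m≡0 _ (m+n≡0⇒m≡0 _ (m+n≡0⇒n≡0 w w+E≡0)))

exchange-gain : ∀ {s u u′ v n} → 3 ≤ s → s + u′ ≡ suc u → n ≤ suc v + u′ → suc n ≤ v + u
exchange-gain {u = u} {u′} {v} {n} 3≤s s+u′≡1+u n≤1+v+u′ = begin
  suc n              ≤⟨ s≤s n≤1+v+u′ ⟩
  suc (suc v + u′)   ≡⟨ cong suc (sym (+-suc v u′)) ⟩
  suc (v + suc u′)   ≡⟨ sym (+-suc v (suc u′)) ⟩
  v + (2 + u′)       ≤⟨ +-monoʳ-≤ v 2+u′≤u ⟩
  v + u              ∎
  where
  open ≤-Reasoning
  2+u′≤u : 2 + u′ ≤ u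
  2+u′≤u = ≤-pred (subst (3 + u′ ≤_) s+u′≡1+u (+-monoˡ-≤ u′ 3≤s))

module FrobeniusExchange {a b c : ℕ} .{{_ : NonZero a}} .{{_ : NonZero b}} .{{_ : NonZero c}}
                         (4≤a : 4 ≤ a) (a≤b : a ≤ b) (coprime : Coprime a b)
                         (frobenius : c + a + b ≡ a * b) where

  3≤a : 3 ≤ a
  3≤a = ≤-trans (n≤1+n 3) 4≤a

  3≤b : 3 ≤ b
  3≤b = ≤-trans 3≤a a≤b

  absorb-c : ∀ x y w → x * a + y * b ≡ c + w → suc x * a + suc y * b ≡ a * b + w
  absorb-c x y w eq = begin
    (a + x * a) + (b + y * b)  ≡⟨ interchange a (x * a) b (y * b) ⟩
    (a + b) + (x * a + y * b)  ≡⟨ cong ((a + b) +_) eq ⟩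
    (a + b) + (c + w)          ≡⟨ sym (+-assoc (a + b) c w) ⟩
    (a + b) + c + w            ≡⟨ cong (_+ w) (trans (+-comm (a + b) c) (sym (+-assoc c a b))) ⟩
    c + a + b + w              ≡⟨ cong (_+ w) frobenius ⟩
    a * b + w                  ∎
    where open ≡-Reasoning

  shed-ab-from-b : ∀ x y′ {y w} → a + y′ ≡ y → x * a + y * b ≡ a * b + w → x * a + y′ * b ≡ w
  shed-ab-from-b x y′ {w = w} refl eq = +-cancelˡ-≡ (a * b) _ _ (begin
    a * b + (x * a + y′ * b)  ≡⟨ x∙yz≈y∙xz (a * b) (x * a) (y′ * b) ⟩
    x * a + (a * b + y′ * b)  ≡⟨ cong (x * a +_) (*-distribʳ-+ b a y′) ⟨
    x * a + (a + y′) * b      ≡⟨ eq ⟩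
    a * b + w                 ∎)
    where open ≡-Reasoning

  shed-ab-from-a : ∀ x′ y {x w} → b + x′ ≡ x → x * a + y * b ≡ a * b + w → x′ * a + y * b ≡ w
  shed-ab-from-a x′ y {w = w} refl eq = +-cancelˡ-≡ (a * b) _ _ (begin
    a * b + (x′ * a + y * b)  ≡⟨ +-assoc (a * b) (x′ * a) (y * b) ⟨
    a * b + x′ * a + y * b    ≡⟨ cong (λ t → t + x′ * a + y * b) (*-comm a b) ⟩
    b * a + x′ * a + y * b    ≡⟨ cong (_+ y * b) (*-distribʳ-+ a b x′) ⟨
    (b + x′) * a + y * b      ≡⟨ eq ⟩
    a * b + w                 ∎)
    where open ≡-Reasoning

  module _ (qa qb : ℕ) (qb-maximal : ∀ x y → x * a + y * b ≡ qa * a + qb * b → y ≤ qb) where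

    R : ℕ
    R = qa * a + qb * b

    cost-bound-R : ∀ x y → x * a + y * b ≡ R → qa + qb ≤ x + y
    cost-bound-R x y eq with m≤n⇒∃[o]m+o≡n (qb-maximal x y eq)
    ... | d , y+d≡qb = begin
      qa + qb        ≡⟨ cong (qa +_) (trans (sym y+d≡qb) (+-comm y d)) ⟩
      qa + (d + y)   ≡⟨ +-assoc qa d y ⟨
      qa + d + y     ≤⟨ +-monoˡ-≤ y (coefficient-exchange-≤ a≤b x y qa d eq′) ⟩
      x + y          ∎
      where
      open ≤-Reasoning
      eq′ : x * a + y * b ≡ qa * a + (y + d) * b
      eq′ = trans eq (cong (λ t → qa * a + t * b) (sym y+d≡qb))

    ab+R≡ : a * b + R ≡ (b + qa) * a + qb * b
    ab+R≡ = begin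
      a * b + (qa * a + qb * b)  ≡⟨ +-assoc (a * b) (qa * a) (qb * b) ⟨
      a * b + qa * a + qb * b    ≡⟨ cong (λ t → t + qa * a + qb * b) (*-comm a b) ⟩
      b * a + qa * a + qb * b    ≡⟨ cong (_+ qb * b) (*-distribʳ-+ a b qa) ⟨
      (b + qa) * a + qb * b      ∎
      where open ≡-Reasoning

    -- Either 1 + y ≤ qb, and the a-part alone exceeds b a; or the surplus of b's over qb is a multiple of a.
    no-c-in-box : ∀ x y → x * a + y * b ≡ c + R → suc x < b → suc y < a → ⊥
    no-c-in-box x y eq 1+x<b 1+y<a with suc y ≤? qb
    ... | yes 1+y≤qb with m≤n⇒∃[o]m+o≡n 1+y≤qb
    ...   | d , 1+y+d≡qb = <⇒≱ 1+x<b (begin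
      b               ≤⟨ m≤m+n b qa ⟩
      b + qa          ≤⟨ m≤m+n (b + qa) d ⟩
      b + qa + d      ≤⟨ coefficient-exchange-≤ a≤b (suc x) (suc y) (b + qa) d shifted ⟩
      suc x           ∎)
      where
      open ≤-Reasoning
      shifted : suc x * a + suc y * b ≡ (b + qa) * a + (suc y + d) * b
      shifted = trans (absorb-c x y R eq)
                      (trans ab+R≡ (cong (λ t → (b + qa) * a + t * b) (sym 1+y+d≡qb)))
    no-c-in-box x y eq _ 1+y<a | no 1+y≰qb with m≤n⇒∃[o]m+o≡n (≤-pred (≰⇒> 1+y≰qb))
    ...   | d , qb+d≡y = <⇒≱ 1+y<a (begin
      a              ≤⟨ ∣⇒≤ (coprime-∣-coefficient coprime (suc x) (suc d) (b + qa) surplus) ⟩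
      suc d          ≤⟨ s≤s (m≤n+m d qb) ⟩
      suc (qb + d)   ≡⟨ cong suc qb+d≡y ⟩
      suc y          ∎)
      where
      open ≤-Reasoning
      surplus : suc x * a + suc d * b ≡ (b + qa) * a
      surplus = +-cancelʳ-≡ (qb * b) _ _ (begin-equality
        suc x * a + suc d * b + qb * b    ≡⟨ +-assoc (suc x * a) (suc d * b) (qb * b) ⟩
        suc x * a + (suc d * b + qb * b)  ≡⟨ cong (suc x * a +_) (*-distribʳ-+ b (suc d) qb) ⟨
        suc x * a + (suc d + qb) * b      ≡⟨ cong (λ t → suc x * a + suc t * b) (trans (+-comm d qb) qb+d≡y) ⟩
        suc x * a + suc y * b             ≡⟨ absorb-c x y R eq ⟩
        a * b + R                         ≡⟨ ab+R≡ ⟩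
        (b + qa) * a + qb * b             ∎)

    count-≤-weight : ∀ j → j + (qa + qb) ≤ j * c + R
    count-≤-weight j = +-mono-≤ (m≤m*n j c) (+-mono-≤ (m≤m*n qa a) (m≤m*n qb b))

    c-in-box : ∀ j x y → x * a + y * b ≡ suc j * c + R → suc x < b → suc y < a →
               suc j + (qa + qb) ≤ x + y
    c-in-box zero x y eq 1+x<b 1+y<a =
      ⊥-elim (no-c-in-box x y (trans eq (cong (_+ R) (+-identityʳ c))) 1+x<b 1+y<a)
    -- With two or more c's the box saturates: R = 0, only two c's, and y = a − 2 ≥ 2.
    c-in-box (suc j) x y eq 1+x<b 1+y<a with box-saturation x y (j * c + R) 1+x<b 1+y<a twice-absorbed
      where
      W = j * c + R
      once : suc x * a + suc y * b ≡ c + (a * b + W)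
      once = begin
        suc x * a + suc y * b      ≡⟨ absorb-c x y (c + j * c + R) (trans eq (+-assoc c (c + j * c) R)) ⟩
        a * b + (c + j * c + R)    ≡⟨ cong (a * b +_) (+-assoc c (j * c) R) ⟩
        a * b + (c + W)            ≡⟨ x∙yz≈y∙xz (a * b) c W ⟩
        c + (a * b + W)            ∎
        where open ≡-Reasoning
      twice-absorbed : (2 + x) * a + (2 + y) * b ≡ 2 * (a * b) + W
      twice-absorbed = begin
        (2 + x) * a + (2 + y) * b  ≡⟨ absorb-c (suc x) (suc y) (a * b + W) once ⟩
        a * b + (a * b + W)        ≡⟨ +-assoc (a * b) (a * b) W ⟨
        a * b + a * b + W          ≡⟨ cong (λ t → a * b + t + W) (+-identityʳ (a * b)) ⟨
        2 * (a * b) + W            ∎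
        where open ≡-Reasoning
    ... | W≡0 , 2+y≡a = begin
      2 + (j + (qa + qb))  ≤⟨ +-monoʳ-≤ 2 (≤-trans (count-≤-weight j) (≤-reflexive W≡0)) ⟩
      2                    ≤⟨ +-cancelˡ-≤ 2 2 y (subst (4 ≤_) (sym 2+y≡a) 4≤a) ⟩
      y                    ≤⟨ m≤n+m y x ⟩
      x + y                ∎
      where open ≤-Reasoning

    cost-bound : ∀ j x y → x * a + y * b ≡ j * c + R → j + (qa + qb) ≤ x + y
    cost-bound zero = cost-bound-R
    cost-bound (suc j) x y eq
      with a ≤? suc y | b ≤? suc x | absorb-c x y (j * c + R) (trans eq (+-assoc c (j * c) R))
    ... | yes a≤1+y | _ | absorbed with m≤n⇒∃[o]m+o≡n a≤1+y
    ...   | y′ , a+y′≡1+y = exchange-gain 3≤a a+y′≡1+y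
      (cost-bound j (suc x) y′ (shed-ab-from-b (suc x) y′ a+y′≡1+y absorbed))
    cost-bound (suc j) x y eq | no _ | yes b≤1+x | absorbed with m≤n⇒∃[o]m+o≡n b≤1+x
    ...   | x′ , b+x′≡1+x = subst (suc j + (qa + qb) ≤_) (+-comm y x) (exchange-gain 3≤b b+x′≡1+x
      (subst (j + (qa + qb) ≤_) (+-comm x′ (suc y))
        (cost-bound j x′ (suc y) (shed-ab-from-a x′ (suc y) b+x′≡1+x absorbed))))
    cost-bound (suc j) x y eq | no a≰1+y | no b≰1+x | _ = c-in-box j x y eq (≰⇒> b≰1+x) (≰⇒> a≰1+y)

module FrobeniusGreedy {a b c : ℕ} (4≤a : 4 ≤ a) (a<b : a < b) (b<c : b < c) (coprime : Coprime a b)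
                       (frobenius : c + a + b ≡ a * b) where

  a≤b : a ≤ b
  a≤b = <⇒≤ a<b

  instance
    a≢0 : NonZero a
    a≢0 = >-nonZero (≤-trans (s≤s z≤n) 4≤a)
    b≢0 : NonZero b
    b≢0 = >-nonZero (≤-trans (s≤s z≤n) (≤-trans 4≤a a≤b))
    c≢0 : NonZero c
    c≢0 = >-nonZero (≤-trans (s≤s z≤n) b<c)

  open ThreeGenerators a b c public
  open FrobeniusExchange 4≤a a≤b coprime frobenius

  greedy-optimal : ∀ k m → IsGreedyCost S k m → IsMinCost S k m
  greedy-optimal k m
    (_ , step {q = qc} {r = r₁} k≡ _ max-c (step {q = qb} r₁≡ _ max-b (step {q = qa} r₂≡ _ _ done)) , Σq≡m) =
    ((qa ∷ qb ∷ qc ∷ []) , trans (value-S qa qb qc) (sym k≡greedy) , trans (cost-S qa qb qc) (sym m≡greedy)) ,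
    minimal
    where
    m≡greedy : m ≡ qc + (qa + qb)
    m≡greedy = trans (sym Σq≡m) (cong (qc +_) (trans (cong (qb +_) (+-identityʳ qa)) (+-comm qb qa)))
    r₁≡R : r₁ ≡ qa * a + qb * b
    r₁≡R = trans r₁≡ (trans (cong (qb * b +_) (trans r₂≡ (+-identityʳ (qa * a))))
                            (+-comm (qb * b) (qa * a)))
    k≡greedy : k ≡ qc * c + (qa * a + qb * b)
    k≡greedy = trans k≡ (cong (qc * c +_) r₁≡R)
    qb-maximal : ∀ x y → x * a + y * b ≡ qa * a + qb * b → y ≤ qb
    qb-maximal x y eq =
      max-b y (x * a) (trans r₁≡R (trans (sym eq) (+-comm (x * a) (y * b)))) (a-multiple-∈ x)
    minimal : ∀ v → value S v ≡ k → m ≤ cost v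
    minimal (x ∷ y ∷ z ∷ []) v≡k with m≤n⇒∃[o]m+o≡n z≤qc
      where
      z≤qc : z ≤ qc
      z≤qc = max-c z (x * a + y * b) (trans (sym v≡k) (value-S x y z))
                   (InSG-+ (a-multiple-∈ x) (b-multiple-∈ y))
    ... | j , z+j≡qc = begin
      m                       ≡⟨ m≡greedy ⟩
      qc + (qa + qb)          ≡⟨ cong (_+ (qa + qb)) z+j≡qc ⟨
      z + j + (qa + qb)       ≡⟨ +-assoc z j (qa + qb) ⟩
      z + (j + (qa + qb))     ≤⟨ +-monoʳ-≤ z (cost-bound qa qb qb-maximal j x y rest) ⟩
      z + (x + y)             ≡⟨ cost-S x y z ⟨
      cost (x ∷ y ∷ z ∷ [])   ∎
      where
      open ≤-Reasoning
      rest : x * a + y * b ≡ j * c + (qa * a + qb * b)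
      rest = +-cancelˡ-≡ (z * c) _ _ (begin-equality
        z * c + (x * a + y * b)            ≡⟨ value-S x y z ⟨
        value S (x ∷ y ∷ z ∷ [])           ≡⟨ v≡k ⟩
        k                                  ≡⟨ k≡greedy ⟩
        qc * c + (qa * a + qb * b)         ≡⟨ cong (λ t → t * c + (qa * a + qb * b)) z+j≡qc ⟨
        (z + j) * c + (qa * a + qb * b)    ≡⟨ cong (_+ (qa * a + qb * b)) (*-distribʳ-+ c z j) ⟩
        z * c + j * c + (qa * a + qb * b)  ≡⟨ +-assoc (z * c) (j * c) (qa * a + qb * b) ⟩
        z * c + (j * c + (qa * a + qb * b)) ∎)

corollary1 : (a b c : ℕ) → 4 ≤ a → a < b → b < c → gcd a b ≡ 1 →
             SqrtBound a b → c + a + b ≡ a * b →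
             IsGreedy (a ∷ b ∷ c ∷ [])
corollary1 a b c 4≤a a<b b<c gcd≡1 _ frobenius = greedyCost-exists , greedy-optimal
  where open FrobeniusGreedy 4≤a a<b b<c (gcd≡1⇒coprime gcd≡1) frobenius
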